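{- Let $\mathsf{L}$ be the BWT (of length $n$) of a nullterminated string and let $\mathcal{RB}$ be a set of width-maximal run-blocks of $\mathsf{L}$. Then (1) the number of unordered pairs of distinct blocks in $\mathcal{RB}$ that collide is at most $\sum_{B\in\mathcal{RB}}w_B$, and (2) $\sum_{B\in\mathcal{RB}}w_B\le n$.
   Context: Indices start at 1. For a nullterminated string $S$ (last character is the unique smallest character $\$$) with suffix array $\mathsf{SA}$, the BWT is $\mathsf{L}[i]=S[\mathsf{SA}[i]-1]$ if $\mathsf{SA}[i]>1$, else $\$$. $\mathsf{C}_{\mathsf{L}}[c]$ counts characters of $\mathsf{L}$ smaller than $c$, $\mathsf{rank}_{\mathsf{L}}(c,i)$ counts occurrences of $c$ in $\mathsf{L}[1..i]$, and $\mathsf{LF}[i]=\mathsf{C}_{\mathsf{L}}[\mathsf{L}[i]]+\mathsf{rank}_{\mathsf{L}}(\mathsf{L}[i],i)$, with $\mathsf{LF}^x$ its $x$-fold application ($\mathsf{LF}^0=\mathrm{id}$). A block $d\text{ - }[i,j]$ is an integer $d\ge0$ and interval $[i,j]\subseteq[1,n]$ with $\mathsf{L}[\mathsf{LF}^x[i]]=\dots=\mathsf{L}[\mathsf{LF}^x[j]]$ for all $0\le x\le d$; its height is $h_B=j-i+1$, width $w_B=d+1$, and its $x$-th column is $[\mathsf{LF}^x[i],\mathsf{LF}^x[j]]$. Two different blocks collide if some column of one intersects some column of the other. Assume border characters $\mathsf{L}[0]\ne\mathsf{L}[1]$ and $\mathsf{L}[n+1]\ne\mathsf{L}[n]$. A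 block $d\text{ - }[i,j]$ is a run-block if $\mathsf{L}[i]\ne\mathsf{L}[i-1]$, $\mathsf{L}[j]\ne\mathsf{L}[j+1]$, $\mathsf{L}[\mathsf{LF}^d[i]]\ne\mathsf{L}[\mathsf{LF}^d[i]-1]$ and $\mathsf{L}[\mathsf{LF}^d[j]]\ne\mathsf{L}[\mathsf{LF}^d[j]+1]$. A run-block $RB$ is width-maximal if every run-block $\widetilde{RB}$ that collides with $RB$ and has the same height satisfies $w_{RB}\ge w_{\widetilde{RB}}$. -}

module Defs where

open import Data.Nat using (ℕ; zero; suc; _+_; _∸_; _≤_; _<_; _<ᵇ_; _≡ᵇ_)
open import Data.Bool using (Bool; true; false; if_then_else_)
open import Data.List using (List; []; _∷_; _++_; [_]; drop; length; map)
open import Data.Nat.ListAction using (sum)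
open import Data.Sum using (_⊎_; inj₁; inj₂)
open import Data.List.Relation.Unary.All using (All)
open import Data.List.Relation.Unary.AllPairs using (AllPairs)
open import Data.List.Relation.Binary.Lex.Strict using (Lex-<)
open import Data.List.Membership.Propositional using (_∈_)
open import Data.Product using (Σ; ∃; ∃-syntax; _×_; _,_; proj₁; proj₂)
open import Relation.Binary.PropositionalEquality using (_≡_; _≢_)
open import Relation.Nullary using (¬_)

-- Strings are lists of characters (characters are natural numbers).
-- All positions are 1-based.

-- S[k] (1-based); value 0 outside [1, length S] (never used there).
at : List ℕ → ℕ → ℕ
at []       _             = 0
at (c ∷ cs) zero          = 0
at (c ∷ cs) (suc zero)    = c
at (c ∷ cs) (suc (suc k)) = at cs (suc k)

NullTerminated : List ℕ → Set
NullTerminated S = ∃[ T ] ∃[ c ] (S ≡ T ++ [ c ] × All (c <_) T)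

suffix : List ℕ → ℕ → List ℕ
suffix S i = drop (i ∸ 1) S

_<lex_ : List ℕ → List ℕ → Set
_<lex_ = Lex-< _≡_ _<_

-- SA is the suffix array of S: it maps [1,n] into [1,n] and lists the
-- suffixes in strictly increasing lexicographic order (hence it is the
-- unique permutation sorting the suffixes).
IsSuffixArray : List ℕ → (ℕ → ℕ) → Set
IsSuffixArray S SA =
  (∀ i → 1 ≤ i → i ≤ length S → 1 ≤ SA i × SA i ≤ length S) ×
  (∀ i j → 1 ≤ i → i < j → j ≤ length S → suffix S (SA i) <lex suffix S (SA j))

count : (ℕ → Bool) → ℕ → ℕ
count p zero    = 0
count p (suc m) = (if p (suc m) then 1 else 0) + count p m

iter : (ℕ → ℕ) → ℕ → ℕ → ℕ
iter f zero    k = k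
iter f (suc x) k = f (iter f x k)

record Block : Set where
  constructor blk
  field
    d : ℕ
    i : ℕ
    j : ℕ
open Block public

height : Block → ℕ
height b = suc (j b) ∸ i b

width : Block → ℕ
width b = suc (d b)

module BWT (S : List ℕ) (SA : ℕ → ℕ) where

  n : ℕ
  n = length S

  -- the BWT  L[i] = S[SA[i]-1] if SA[i] > 1, else $ (= S[n])
  L : ℕ → ℕ
  L i with SA i
  ... | zero        = at S n
  ... | suc zero    = at S n
  ... | suc (suc k) = at S (suc k)

  C : ℕ → ℕ
  C c = count (λ k → L k <ᵇ c) n

  rank : ℕ → ℕ → ℕ
  rank c i = count (λ k → L k ≡ᵇ c) i

  LF : ℕ → ℕ
  LF i = C (L i) + rank (L i) i

  LF^ : ℕ → ℕ → ℕ
  LF^ x = iter LF x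

  IsBlock : Block → Set
  IsBlock b = 1 ≤ i b × i b ≤ j b × j b ≤ n ×
    (∀ x → x ≤ d b → ∀ k → i b ≤ k → k ≤ j b → L (LF^ x k) ≡ L (LF^ x (i b)))

  InColumn : Block → ℕ → ℕ → Set
  InColumn b x p = LF^ x (i b) ≤ p × p ≤ LF^ x (j b)

  Collide : Block → Block → Set
  Collide b b′ = b ≢ b′ ×
    ∃[ x ] ∃[ y ] ∃[ p ] (x ≤ d b × y ≤ d b′ × InColumn b x p × InColumn b′ y p)

  -- L[p] ≠ L[p-1], with the border convention L[0] ≠ L[1]
  LeftBorder : ℕ → Set
  LeftBorder p = p ≡ 1 ⊎ L p ≢ L (p ∸ 1)

  -- L[p] ≠ L[p+1], with the border convention L[n+1] ≠ L[n]
  RightBorder : ℕ → Set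
  RightBorder p = p ≡ n ⊎ L p ≢ L (suc p)

  IsRunBlock : Block → Set
  IsRunBlock b = IsBlock b ×
    LeftBorder (i b) × RightBorder (j b) ×
    LeftBorder (LF^ (d b) (i b)) × RightBorder (LF^ (d b) (j b))

  IsWidthMaximal : Block → Set
  IsWidthMaximal b = IsRunBlock b ×
    (∀ b′ → IsRunBlock b′ → Collide b b′ → height b′ ≡ height b →
      width b′ ≤ width b)

-- unordered pairs given as ordered pairs; two entries denote the same
-- unordered pair iff they are equal or swapped
SameUnorderedPair : Block × Block → Block × Block → Set
SameUnorderedPair (a , b) (a′ , b′) = (a ≡ a′ × b ≡ b′) ⊎ (a ≡ b′ × b ≡ a′)

totalWidth : List Block → ℕ
totalWidth RB = sum (map width RB)

-- Within a block, LF^x maps the rows onto the x-th column by a translation, and LF is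
-- injective on [1, n]. So if column x of B meets column y ≤ x of B′, then column x − y of B,
-- a constant interval, meets the rows of B′, which are bordered by run boundaries; hence it lies
-- inside them, and applying LF^y, column x of B lies inside column y of B′: all columns form a
-- laminar family. If column x − y of B even equals the rows of B′ and x > y, then the first
-- x − y columns of B followed by B′ form a wider run-block of the same height colliding with B′,
-- contradicting width-maximality; the same happens for a one-row block and its LF-cycle.
-- Consequently the columns of width-maximal run-blocks are distinct intervals of length ≥ 2,
-- and two of these blocks whose rows meet are equal.
-- (1) charges each colliding pair to the column x − y of one of its blocks: the other block is
-- recovered as the one whose rows contain the left end of that column. (2) holds because a
-- laminar family of distinct intervals of length ≥ 2 inside [1, n] has fewer than n members.
-- LF is injective for every L.

module Submission where

open import Defs
open import Data.Bool using (Bool; true; false; if_then_else_; T)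
open import Data.Empty using (⊥; ⊥-elim)
open import Data.Fin using (toℕ; fromℕ<)
open import Data.Fin.Properties using (pigeonhole; toℕ-fromℕ<)
open import Data.List using (List; []; _∷_; length; map; filter; upTo; _++_)
open import Data.List.Extrema.Nat using (max; ⊥≤max; max<v⁺; xs≤max; argmax-sel)
open import Data.List.Membership.Propositional using (_∈_; _─_)
open import Data.List.Membership.Propositional.Properties
  using (∈-map⁺; ∈-map⁻; ∈-filter⁺; ∈-filter⁻; ∈-++⁺ˡ; ∈-++⁺ʳ; ∈-++⁻; ∈-upTo⁺; ∈-upTo⁻)
open import Data.List.Properties using (length-++; length-map; length-upTo; length-removeAt′)
open import Data.List.Relation.Unary.Any using (here; there; index)
open import Data.List.Relation.Unary.All as All using (All; []; _∷_)
open import Data.List.Relation.Unary.AllPairs using (AllPairs; []; _∷_)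
open import Data.List.Relation.Unary.Unique.Propositional using (Unique)
open import Data.List.Relation.Unary.Unique.Propositional.Properties using (upTo⁺; map⁺; ++⁺)
open import Data.Nat
open import Data.Nat.Properties
open import Data.Product using (∃-syntax; _×_; _,_; proj₁; proj₂)
open import Data.Sum using (_⊎_; inj₁; inj₂; [_,_]′)
open import Relation.Binary.PropositionalEquality
open import Relation.Binary using (tri<; tri≈; tri>)
open import Relation.Nullary using (¬_; Dec; yes; no)
open import Relation.Nullary.Decidable using (_×-dec_)
open import Relation.Nullary.Reflects using (Reflects; ofʸ; ofⁿ; fromEquivalence)
open import Algebra.Properties.CommutativeSemigroup +-commutativeSemigroup using (interchange)

indicator : (ℕ → Bool) → ℕ → ℕ
indicator p k = if p k then 1 else 0

indicator≤1 : ∀ p k → indicator p k ≤ 1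
indicator≤1 p k with p k
... | true  = ≤-refl
... | false = z≤n

count≤ : ∀ p m → count p m ≤ m
count≤ p zero    = z≤n
count≤ p (suc m) = +-mono-≤ (indicator≤1 p (suc m)) (count≤ p m)

count-mono : ∀ p {m m′} → m ≤ m′ → count p m ≤ count p m′
count-mono p {m′ = zero}   z≤n = ≤-refl
count-mono p {m} {suc m′} m≤1+m′ with m≤n⇒m<n∨m≡n m≤1+m′
... | inj₁ (s≤s m≤m′) = ≤-trans (count-mono p m≤m′) (m≤n+m _ _)
... | inj₂ refl       = ≤-refl

count-suc-hit : ∀ p m → T (p (suc m)) → count p (suc m) ≡ suc (count p m)
count-suc-hit p m hit with p (suc m)
count-suc-hit p m _  | true = refl

count-+-≤ : ∀ p q r → (∀ k → indicator p k + indicator q k ≤ indicator r k) →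
            ∀ m → count p m + count q m ≤ count r m
count-+-≤ p q r pointwise zero    = z≤n
count-+-≤ p q r pointwise (suc m) = begin
  (indicator p (suc m) + count p m) + (indicator q (suc m) + count q m)
    ≡⟨ interchange (indicator p (suc m)) (count p m) (indicator q (suc m)) (count q m) ⟩
  (indicator p (suc m) + indicator q (suc m)) + (count p m + count q m)
    ≤⟨ +-mono-≤ (pointwise (suc m)) (count-+-≤ p q r pointwise m) ⟩
  indicator r (suc m) + count r m ∎
  where open ≤-Reasoning

≡ᵇ-reflects-≡ : ∀ m n → Reflects (m ≡ n) (m ≡ᵇ n)
≡ᵇ-reflects-≡ m n = fromEquivalence (≡ᵇ⇒≡ m n) (≡⇒≡ᵇ m n)

indicator-<ᵇ-≡ᵇ : ∀ x {c c′} → c < c′ →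
  (if x <ᵇ c then 1 else 0) + (if x ≡ᵇ c then 1 else 0) ≤ (if x <ᵇ c′ then 1 else 0)
indicator-<ᵇ-≡ᵇ x {c} {c′} c<c′
  with x <ᵇ c | <ᵇ-reflects-< x c | x ≡ᵇ c | ≡ᵇ-reflects-≡ x c | x <ᵇ c′ | <ᵇ-reflects-< x c′
... | true  | ofʸ x<c | true  | ofʸ refl | _     | _         = ⊥-elim (<-irrefl refl x<c)
... | true  | _       | false | _        | true  | _         = ≤-refl
... | true  | ofʸ x<c | false | _        | false | ofⁿ x≮c′ = ⊥-elim (x≮c′ (<-trans x<c c<c′))
... | false | _       | true  | _        | true  | _         = ≤-refl
... | false | _       | true  | ofʸ refl | false | ofⁿ x≮c′ = ⊥-elim (x≮c′ c<c′)
... | false | _       | false | _        | _     | _         = z≤n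

∈-─⁺ : ∀ {A : Set} {v w : A} {ys} (w∈ys : w ∈ ys) → v ∈ ys → v ≢ w → v ∈ ys ─ w∈ys
∈-─⁺ (here refl) (here refl) v≢w = ⊥-elim (v≢w refl)
∈-─⁺ (here _)    (there v∈) _    = v∈
∈-─⁺ (there _)   (here refl) _   = here refl
∈-─⁺ (there w∈)  (there v∈) v≢w  = there (∈-─⁺ w∈ v∈ v≢w)

module _ {A B : Set} {R : A → A → Set} (Q : A → B → Set)
         (Q-injective : ∀ {x y v} → Q x v → Q y v → R x y) where

  length-≤-by-injection : ∀ {xs ys} → AllPairs (λ x y → ¬ R x y) xs →
    All (λ x → ∃[ v ] v ∈ ys × Q x v) xs → length xs ≤ length ys
  length-≤-by-injection [] [] = z≤n
  length-≤-by-injection {x ∷ xs} {ys} (x≁xs ∷ xs-apart) ((v , v∈ys , Qxv) ∷ images) =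
    subst (suc (length xs) ≤_) (sym (length-removeAt′ ys (index v∈ys)))
      (s≤s (length-≤-by-injection xs-apart (All.zipWith avoid-v (x≁xs , images))))
    where
    avoid-v : ∀ {y} → ¬ R x y × (∃[ w ] w ∈ ys × Q y w) → ∃[ w ] w ∈ ys ─ v∈ys × Q y w
    avoid-v (x≁y , w , w∈ys , Qyw) = w , ∈-─⁺ v∈ys w∈ys (λ { refl → x≁y (Q-injective Qxv Qyw) }) , Qyw

orientations⇒SameUnorderedPair : ∀ {q r : Block × Block} {a b : Block} →
  q ≡ (a , b) ⊎ q ≡ (b , a) → r ≡ (a , b) ⊎ r ≡ (b , a) → SameUnorderedPair q r
orientations⇒SameUnorderedPair (inj₁ refl) (inj₁ refl) = inj₁ (refl , refl)
orientations⇒SameUnorderedPair (inj₁ refl) (inj₂ refl) = inj₂ (refl , refl)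
orientations⇒SameUnorderedPair (inj₂ refl) (inj₁ refl) = inj₂ (refl , refl)
orientations⇒SameUnorderedPair (inj₂ refl) (inj₂ refl) = inj₁ (refl , refl)

Interval : Set
Interval = ℕ × ℕ

_∈ᴵ_ : ℕ → Interval → Set
p ∈ᴵ I = proj₁ I ≤ p × p ≤ proj₂ I

_⊆ᴵ_ : Interval → Interval → Set
I ⊆ᴵ J = proj₁ J ≤ proj₁ I × proj₂ I ≤ proj₂ J

Laminar : List Interval → Set
Laminar F = ∀ {I J} → I ∈ F → J ∈ F → ∀ {p} → p ∈ᴵ I → p ∈ᴵ J → I ⊆ᴵ J ⊎ J ⊆ᴵ I

module _ (F : List Interval) where

  innerPrefix? : (I K : Interval) → Dec (proj₁ K ≡ proj₁ I × proj₂ K < proj₂ I)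
  innerPrefix? I K = (proj₁ K ≟ proj₁ I) ×-dec (proj₂ K <? proj₂ I)

  innerPrefixEnds : Interval → List ℕ
  innerPrefixEnds I = map proj₂ (filter (innerPrefix? I) F)

  -- For laminar F of intervals of length ≥ 2, I ↦ splitPoint I is injective on F and takes
  -- values in [lo I, hi I): every such family inside [1, n] has fewer than n members.
  splitPoint : Interval → ℕ
  splitPoint I = max (proj₁ I) (innerPrefixEnds I)

  splitPoint-≥ : ∀ I → proj₁ I ≤ splitPoint I
  splitPoint-≥ I = ⊥≤max (proj₁ I) (innerPrefixEnds I)

  splitPoint-< : ∀ {I} → proj₁ I < proj₂ I → splitPoint I < proj₂ I
  splitPoint-< {I} lo<hi = max<v⁺ {xs = innerPrefixEnds I} lo<hi (All.tabulate λ h∈ →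
    let K , K∈ , h≡ = ∈-map⁻ proj₂ h∈ in
    subst (_< proj₂ I) (sym h≡) (proj₂ (proj₂ (∈-filter⁻ (innerPrefix? I) {xs = F} K∈))))

  innerPrefix≤splitPoint : ∀ {I K} → K ∈ F → proj₁ K ≡ proj₁ I → proj₂ K < proj₂ I →
    proj₂ K ≤ splitPoint I
  innerPrefix≤splitPoint {I} K∈F lo≡ hi< =
    All.lookup (xs≤max _ _) (∈-map⁺ proj₂ (∈-filter⁺ (innerPrefix? I) K∈F (lo≡ , hi<)))

  splitPoint-sel : ∀ I → splitPoint I ≡ proj₁ I ⊎
    ∃[ K ] K ∈ F × proj₁ K ≡ proj₁ I × proj₂ K < proj₂ I × splitPoint I ≡ proj₂ K
  splitPoint-sel I with argmax-sel (λ h → h) (proj₁ I) (innerPrefixEnds I)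
  ... | inj₁ ≡lo = inj₁ ≡lo
  ... | inj₂ ∈ends with ∈-map⁻ proj₂ ∈ends
  ...   | K , K∈ , ≡hi with ∈-filter⁻ (innerPrefix? I) K∈
  ...     | K∈F , lo≡ , hi< = inj₂ (K , K∈F , lo≡ , hi< , ≡hi)

  module _ (laminar : Laminar F) (nontrivial : ∀ {K} → K ∈ F → proj₁ K < proj₂ K) where

    splitPoint-injective-nested : ∀ {I J} → I ∈ F → J ∈ F → J ⊆ᴵ I →
      splitPoint I ≡ splitPoint J → I ≡ J
    splitPoint-injective-nested {I} {J} I∈ J∈ (lo≤ , hi≤) split≡ with proj₁ J ≟ proj₁ I
    ... | yes lo≡ = same-left lo≡
      where
      same-left : proj₁ J ≡ proj₁ I → I ≡ J
      same-left lo≡ with proj₂ J <? proj₂ I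
      ... | yes hi< = ⊥-elim (<-irrefl refl (begin-strict
            proj₂ J      ≤⟨ innerPrefix≤splitPoint J∈ lo≡ hi< ⟩
            splitPoint I ≡⟨ split≡ ⟩
            splitPoint J <⟨ splitPoint-< (nontrivial J∈) ⟩
            proj₂ J      ∎))
        where open ≤-Reasoning
      ... | no hi≮ = cong₂ _,_ (sym lo≡) (≤-antisym (≮⇒≥ hi≮) hi≤)
    ... | no lo≢ = ⊥-elim (J-not-prefix (≤∧≢⇒< lo≤ (λ e → lo≢ (sym e))))
      where
      splitJ<hiJ : splitPoint I < proj₂ J
      splitJ<hiJ = subst (_< proj₂ J) (sym split≡) (splitPoint-< (nontrivial J∈))

      loJ≤split : proj₁ J ≤ splitPoint I
      loJ≤split = subst (proj₁ J ≤_) (sym split≡) (splitPoint-≥ J)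

      J-not-prefix : proj₁ I < proj₁ J → ⊥
      J-not-prefix lo< with splitPoint-sel I
      ... | inj₁ split≡lo = <⇒≱ lo< (subst (proj₁ J ≤_) split≡lo loJ≤split)
      ... | inj₂ (K , K∈ , loK≡ , hiK< , split≡hiK) =
        [ (λ K⊆J → <⇒≱ lo< (subst (proj₁ J ≤_) loK≡ (proj₁ K⊆J)))
        , (λ J⊆K → <⇒≱ splitJ<hiJ (subst (proj₂ J ≤_) (sym split≡hiK) (proj₂ J⊆K)))
        ]′ (laminar K∈ J∈ hiK∈K hiK∈J)
        where
        hiK∈K : proj₂ K ∈ᴵ K
        hiK∈K = subst (_≤ proj₂ K) (sym loK≡) (subst (proj₁ I ≤_) split≡hiK (splitPoint-≥ I)) , ≤-refl
        hiK∈J : proj₂ K ∈ᴵ J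
        hiK∈J = subst (proj₁ J ≤_) split≡hiK loJ≤split , subst (_≤ proj₂ J) split≡hiK (<⇒≤ splitJ<hiJ)

    splitPoint-injective : ∀ {I J} → I ∈ F → J ∈ F → splitPoint I ≡ splitPoint J → I ≡ J
    splitPoint-injective {I} {J} I∈ J∈ split≡ =
      [ (λ I⊆J → sym (splitPoint-injective-nested J∈ I∈ I⊆J (sym split≡)))
      , (λ J⊆I → splitPoint-injective-nested I∈ J∈ J⊆I split≡)
      ]′ (laminar I∈ J∈ (splitPoint-∈ᴵ I∈) (subst (_∈ᴵ J) (sym split≡) (splitPoint-∈ᴵ J∈)))
      where
      splitPoint-∈ᴵ : ∀ {K} → K ∈ F → splitPoint K ∈ᴵ K
      splitPoint-∈ᴵ {K} K∈ = splitPoint-≥ K , <⇒≤ (splitPoint-< (nontrivial K∈))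

columnsOf : Block → List (Block × ℕ)
columnsOf b = map (b ,_) (upTo (width b))

columns : List Block → List (Block × ℕ)
columns []       = []
columns (b ∷ RB) = columnsOf b ++ columns RB

length-columns : ∀ RB → length (columns RB) ≡ totalWidth RB
length-columns []       = refl
length-columns (b ∷ RB) = begin
  length (columnsOf b ++ columns RB)           ≡⟨ length-++ (columnsOf b) ⟩
  length (columnsOf b) + length (columns RB)   ≡⟨ cong₂ _+_ length-columnsOf (length-columns RB) ⟩
  width b + totalWidth RB                      ∎
  where
  open ≡-Reasoning
  length-columnsOf : length (columnsOf b) ≡ width b
  length-columnsOf = trans (length-map (b ,_) (upTo (width b))) (length-upTo (width b))

∈-columns⁺ : ∀ {RB b x} → b ∈ RB → x ≤ d b → (b , x) ∈ columns RB
∈-columns⁺ {b ∷ RB} (here refl) x≤d = ∈-++⁺ˡ (∈-map⁺ (b ,_) (∈-upTo⁺ (s≤s x≤d)))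
∈-columns⁺ {b ∷ RB} (there b∈) x≤d = ∈-++⁺ʳ (columnsOf b) (∈-columns⁺ b∈ x≤d)

∈-columns⁻ : ∀ {RB b x} → (b , x) ∈ columns RB → b ∈ RB × x ≤ d b
∈-columns⁻ {b ∷ RB} v∈ with ∈-++⁻ (columnsOf b) v∈
... | inj₁ v∈b with ∈-map⁻ (b ,_) v∈b
...   | _ , x∈ , refl = here refl , s≤s⁻¹ (∈-upTo⁻ x∈)
∈-columns⁻ {b ∷ RB} v∈ | inj₂ v∈RB = let b∈ , x≤d = ∈-columns⁻ v∈RB in there b∈ , x≤d

columns-unique : ∀ {RB} → Unique RB → Unique (columns RB)
columns-unique {[]}     []               = []
columns-unique {b ∷ RB} (b∉RB ∷ unique) =
  ++⁺ (map⁺ (cong proj₂) (upTo⁺ (width b))) (columns-unique unique) disjoint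
  where
  disjoint : ∀ {v} → ¬ (v ∈ columnsOf b × v ∈ columns RB)
  disjoint (v∈b , v∈RB) with ∈-map⁻ (b ,_) v∈b
  ... | _ , _ , refl = All.lookup b∉RB (proj₁ (∈-columns⁻ v∈RB)) refl

iter-+ : ∀ f a b k → iter f (a + b) k ≡ iter f a (iter f b k)
iter-+ f zero    b k = refl
iter-+ f (suc a) b k = cong f (iter-+ f a b k)

module WidthMaximalRunBlocks (S : List ℕ) (SA : ℕ → ℕ) where

  open BWT S SA

  positions : Interval
  positions = 1 , n

  rows : Block → Interval
  rows b = i b , j b

  column : Block → ℕ → Interval
  column b x = LF^ x (i b) , LF^ x (j b)

  Constant : Interval → Set
  Constant I = ∀ {p} → p ∈ᴵ I → L p ≡ L (proj₁ I)

  rank-pos : ∀ {k} → 1 ≤ k → 1 ≤ rank (L k) k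
  rank-pos {suc k} _ = subst (1 ≤_) (sym (count-suc-hit _ k (≡⇒≡ᵇ (L (suc k)) _ refl))) (s≤s z≤n)

  rank-< : ∀ {c k k′} → k < k′ → L k′ ≡ c → rank c k < rank c k′
  rank-< {c} {k} {suc k′} (s≤s k≤k′) L≡c =
    subst (rank c k <_) (sym (count-suc-hit _ k′ (≡⇒≡ᵇ _ _ L≡c))) (s≤s (count-mono _ k≤k′))

  C+rank≤C : ∀ {c c′} → c < c′ → C c + rank c n ≤ C c′
  C+rank≤C c<c′ = count-+-≤ _ _ _ (λ k → indicator-<ᵇ-≡ᵇ (L k) c<c′) n

  LF≤C : ∀ {k c} → k ≤ n → L k < c → LF k ≤ C c
  LF≤C {k} k≤n Lk<c = ≤-trans (+-monoʳ-≤ (C (L k)) (count-mono _ k≤n)) (C+rank≤C Lk<c)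

  LF-range : ∀ {k} → k ∈ᴵ positions → LF k ∈ᴵ positions
  LF-range {k} (1≤k , k≤n) =
    ≤-trans (rank-pos 1≤k) (m≤n+m _ _) , ≤-trans (LF≤C k≤n (n<1+n (L k))) (count≤ _ n)

  LF-<-char : ∀ {k k′} → k ≤ n → 1 ≤ k′ → L k < L k′ → LF k < LF k′
  LF-<-char {k} {k′} k≤n 1≤k′ Lk<Lk′ = ≤-<-trans (LF≤C k≤n Lk<Lk′) (m<m+n (C (L k′)) (rank-pos 1≤k′))

  LF-<-rank : ∀ {k k′} → k < k′ → L k ≡ L k′ → LF k < LF k′
  LF-<-rank {k} {k′} k<k′ Lk≡Lk′ =
    subst (λ c → C c + rank c k < LF k′) (sym Lk≡Lk′) (+-monoʳ-< (C (L k′)) (rank-< k<k′ refl))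

  LF-injective : ∀ {k k′} → k ∈ᴵ positions → k′ ∈ᴵ positions → LF k ≡ LF k′ → k ≡ k′
  LF-injective {k} {k′} (1≤k , k≤n) (1≤k′ , k′≤n) LF≡ with <-cmp (L k) (L k′) | <-cmp k k′
  ... | tri< Lk<Lk′ _ _ | _               = ⊥-elim (<-irrefl LF≡ (LF-<-char k≤n 1≤k′ Lk<Lk′))
  ... | tri> _ _ Lk>Lk′ | _               = ⊥-elim (<-irrefl (sym LF≡) (LF-<-char k′≤n 1≤k Lk>Lk′))
  ... | tri≈ _ Lk≡Lk′ _ | tri< k<k′ _ _   = ⊥-elim (<-irrefl LF≡ (LF-<-rank k<k′ Lk≡Lk′))
  ... | tri≈ _ _ _      | tri≈ _ k≡k′ _   = k≡k′
  ... | tri≈ _ Lk≡Lk′ _ | tri> _ _ k>k′   = ⊥-elim (<-irrefl (sym LF≡) (LF-<-rank k>k′ (sym Lk≡Lk′)))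

  LF-suc : ∀ {k} → L k ≡ L (suc k) → LF (suc k) ≡ suc (LF k)
  LF-suc {k} Lk≡ = begin
    C (L (suc k)) + rank (L (suc k)) (suc k) ≡⟨ cong (λ c → C c + rank c (suc k)) (sym Lk≡) ⟩
    C (L k) + rank (L k) (suc k)             ≡⟨ cong (C (L k) +_) (count-suc-hit _ k (≡⇒≡ᵇ _ _ (sym Lk≡))) ⟩
    C (L k) + suc (rank (L k) k)             ≡⟨ +-suc (C (L k)) (rank (L k) k) ⟩
    suc (LF k)                               ∎
    where open ≡-Reasoning

  LF-+ : ∀ a t → (∀ {u} → u ≤ t → L (a + u) ≡ L a) → LF (a + t) ≡ LF a + t
  LF-+ a zero    _     = trans (cong LF (+-identityʳ a)) (sym (+-identityʳ (LF a)))
  LF-+ a (suc t) const = begin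
    LF (a + suc t)   ≡⟨ cong LF (+-suc a t) ⟩
    LF (suc (a + t)) ≡⟨ LF-suc (trans (const (n≤1+n t)) (sym L-next≡)) ⟩
    suc (LF (a + t)) ≡⟨ cong suc (LF-+ a t (λ u≤t → const (m≤n⇒m≤1+n u≤t))) ⟩
    suc (LF a + t)   ≡⟨ sym (+-suc (LF a) t) ⟩
    LF a + suc t     ∎
    where
    open ≡-Reasoning
    L-next≡ : L (suc (a + t)) ≡ L a
    L-next≡ = trans (cong L (sym (+-suc a t))) (const ≤-refl)

  LF^-+ : ∀ a b k → LF^ (a + b) k ≡ LF^ a (LF^ b k)
  LF^-+ = iter-+ LF

  LF^-range : ∀ x {k} → k ∈ᴵ positions → LF^ x k ∈ᴵ positions
  LF^-range zero    k∈ = k∈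
  LF^-range (suc x) k∈ = LF-range (LF^-range x k∈)

  LF^-injective : ∀ x {k k′} → k ∈ᴵ positions → k′ ∈ᴵ positions → LF^ x k ≡ LF^ x k′ → k ≡ k′
  LF^-injective zero    _  _   LF^≡ = LF^≡
  LF^-injective (suc x) k∈ k′∈ LF^≡ =
    LF^-injective x k∈ k′∈ (LF-injective (LF^-range x k∈) (LF^-range x k′∈) LF^≡)

  LF^∸1<n : ∀ t {k} → k ∈ᴵ positions → LF^ t k ∸ 1 < n
  LF^∸1<n t k∈ = let 1≤ , ≤n = LF^-range t k∈ in subst (_≤ n) (+-∸-assoc 1 1≤) ≤n

  LF^-periodic : ∀ {k} → k ∈ᴵ positions → ∃[ q ] 1 ≤ q × LF^ q k ≡ k
  LF^-periodic {k} k∈ with pigeonhole (n<1+n n) (λ t → fromℕ< (LF^∸1<n (toℕ t) k∈))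
  ... | a , b , a<b , f≡ = toℕ b ∸ toℕ a , m<n⇒0<n∸m a<b ,
        LF^-injective (toℕ a) (LF^-range (toℕ b ∸ toℕ a) k∈) k∈ (begin
          LF^ (toℕ a) (LF^ (toℕ b ∸ toℕ a) k) ≡⟨ sym (LF^-+ (toℕ a) _ k) ⟩
          LF^ (toℕ a + (toℕ b ∸ toℕ a)) k     ≡⟨ cong (λ t → LF^ t k) (m+[n∸m]≡n (<⇒≤ a<b)) ⟩
          LF^ (toℕ b) k                       ≡⟨ sym (∸-cancelʳ-≡ (1≤LF^ (toℕ a)) (1≤LF^ (toℕ b)) ∸1≡) ⟩
          LF^ (toℕ a) k                       ∎)
    where
    open ≡-Reasoning
    ∸1≡ : LF^ (toℕ a) k ∸ 1 ≡ LF^ (toℕ b) k ∸ 1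
    ∸1≡ = trans (sym (toℕ-fromℕ< _)) (trans (cong toℕ f≡) (toℕ-fromℕ< _))
    1≤LF^ : ∀ t → 1 ≤ LF^ t k
    1≤LF^ t = proj₁ (LF^-range t k∈)

  LF^-∸ : ∀ {x y} → y ≤ x → ∀ k → LF^ x k ≡ LF^ y (LF^ (x ∸ y) k)
  LF^-∸ {x} {y} y≤x k = trans (cong (λ t → LF^ t k) (sym (m+[n∸m]≡n y≤x))) (LF^-+ y (x ∸ y) k)

  module _ {b : Block} (isBlock : IsBlock b) where

    private
      1≤i = proj₁ isBlock
      i≤j = proj₁ (proj₂ isBlock)
      j≤n = proj₁ (proj₂ (proj₂ isBlock))
      sameChar = proj₂ (proj₂ (proj₂ isBlock))

    rows⊆positions : ∀ {k} → k ∈ᴵ rows b → k ∈ᴵ positions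
    rows⊆positions (i≤k , k≤j) = ≤-trans 1≤i i≤k , ≤-trans k≤j j≤n

    column⊆positions : ∀ x → column b x ⊆ᴵ positions
    column⊆positions x = proj₁ (LF^-range x (rows⊆positions (≤-refl , i≤j))) ,
                         proj₂ (LF^-range x (rows⊆positions (i≤j , ≤-refl)))

    column-shift : ∀ {x} → x ≤ d b → ∀ {k} → k ∈ᴵ rows b → LF^ x k ≡ LF^ x (i b) + (k ∸ i b)
    column-shift {zero}  _   (i≤k , _)          = sym (m+[n∸m]≡n i≤k)
    column-shift {suc x} x<d {k} k∈@(i≤k , k≤j) = begin
      LF (LF^ x k)                 ≡⟨ cong LF (column-shift x≤d k∈) ⟩
      LF (LF^ x (i b) + (k ∸ i b)) ≡⟨ LF-+ (LF^ x (i b)) (k ∸ i b) column-x-constant ⟩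
      LF (LF^ x (i b)) + (k ∸ i b) ∎
      where
      open ≡-Reasoning
      x≤d : x ≤ d b
      x≤d = <⇒≤ x<d
      column-x-constant : ∀ {u} → u ≤ k ∸ i b → L (LF^ x (i b) + u) ≡ L (LF^ x (i b))
      column-x-constant {u} u≤ = begin
        L (LF^ x (i b) + u) ≡⟨ cong L (sym shifted) ⟩
        L (LF^ x (i b + u)) ≡⟨ sameChar x x≤d (i b + u) (m≤m+n (i b) u) i+u≤j ⟩
        L (LF^ x (i b))     ∎
        where
        i+u≤j : i b + u ≤ j b
        i+u≤j = ≤-trans (+-monoʳ-≤ (i b) u≤) (subst (_≤ j b) (sym (m+[n∸m]≡n i≤k)) k≤j)
        shifted : LF^ x (i b + u) ≡ LF^ x (i b) + u
        shifted = trans (column-shift x≤d (m≤m+n (i b) u , i+u≤j)) (cong (LF^ x (i b) +_) (m+n∸m≡n (i b) u))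

    column-length : ∀ {x} → x ≤ d b → LF^ x (j b) ≡ LF^ x (i b) + (j b ∸ i b)
    column-length x≤d = column-shift x≤d (i≤j , ≤-refl)

    column-mono : ∀ {x} → x ≤ d b → ∀ {k k′} → k ∈ᴵ rows b → k′ ∈ᴵ rows b → k ≤ k′ →
      LF^ x k ≤ LF^ x k′
    column-mono x≤d k∈ k′∈ k≤k′ =
      subst₂ _≤_ (sym (column-shift x≤d k∈)) (sym (column-shift x≤d k′∈))
        (+-monoʳ-≤ _ (∸-monoˡ-≤ (i b) k≤k′))

    LF^-∈-column : ∀ {x} → x ≤ d b → ∀ {k} → k ∈ᴵ rows b → LF^ x k ∈ᴵ column b x
    LF^-∈-column x≤d k∈@(i≤k , k≤j) =
      column-mono x≤d (≤-refl , i≤j) k∈ i≤k , column-mono x≤d k∈ (i≤j , ≤-refl) k≤j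

    column-cover : ∀ {x} → x ≤ d b → ∀ {p} → p ∈ᴵ column b x → ∃[ k ] k ∈ᴵ rows b × LF^ x k ≡ p
    column-cover {x} x≤d {p} (lo≤p , p≤hi) = i b + t , (m≤m+n (i b) t , i+t≤j) , (begin
      LF^ x (i b + t)             ≡⟨ column-shift x≤d (m≤m+n (i b) t , i+t≤j) ⟩
      LF^ x (i b) + (i b + t ∸ i b) ≡⟨ cong (LF^ x (i b) +_) (m+n∸m≡n (i b) t) ⟩
      LF^ x (i b) + t             ≡⟨ m+[n∸m]≡n lo≤p ⟩
      p                           ∎)
      where
      open ≡-Reasoning
      t = p ∸ LF^ x (i b)
      t≤ : t ≤ j b ∸ i b
      t≤ = subst (t ≤_) (trans (cong (_∸ LF^ x (i b)) (column-length x≤d)) (m+n∸m≡n (LF^ x (i b)) _))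
             (∸-monoˡ-≤ (LF^ x (i b)) p≤hi)
      i+t≤j : i b + t ≤ j b
      i+t≤j = subst (i b + t ≤_) (m+[n∸m]≡n i≤j) (+-monoʳ-≤ (i b) t≤)

    column-constant : ∀ {x} → x ≤ d b → Constant (column b x)
    column-constant {x} x≤d p∈ with column-cover x≤d p∈
    ... | k , (i≤k , k≤j) , refl = sameChar x x≤d k i≤k k≤j

    column-ends-∈ : ∀ {x I} → x ≤ d b → column b x ⊆ᴵ I → LF^ x (i b) ∈ᴵ I × LF^ x (j b) ∈ᴵ I
    column-ends-∈ x≤d (lo≤ , ≤hi) = (lo≤ , ≤-trans lo≤hi ≤hi) , (≤-trans lo≤ lo≤hi , ≤hi)
      where lo≤hi = proj₂ (LF^-∈-column x≤d (≤-refl , i≤j))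

  constant⊆bordered : ∀ {I r w p} → Constant I → I ⊆ᴵ positions → LeftBorder r → RightBorder w →
    p ∈ᴵ I → p ∈ᴵ (r , w) → I ⊆ᴵ (r , w)
  constant⊆bordered {a , z} {r} {w} const (1≤a , z≤last) left right (a≤p , p≤z) (r≤p , p≤w) =
    r≤a , z≤w
    where
    r≤a : r ≤ a
    r≤a with r ≤? a
    ... | yes r≤a = r≤a
    ... | no  r≰a = ⊥-elim (no-left-border left)
      where
      a<r : a < r
      a<r = ≰⇒> r≰a
      no-left-border : LeftBorder r → ⊥
      no-left-border (inj₁ refl) = <⇒≱ a<r 1≤a
      no-left-border (inj₂ L≢) = L≢ (trans (const (<⇒≤ a<r , ≤-trans r≤p p≤z))
        (sym (const (∸-monoˡ-≤ 1 a<r , ≤-trans (m∸n≤m r 1) (≤-trans r≤p p≤z)))))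
    z≤w : z ≤ w
    z≤w with z ≤? w
    ... | yes z≤w = z≤w
    ... | no  z≰w = ⊥-elim (no-right-border right)
      where
      w<z : w < z
      w<z = ≰⇒> z≰w
      no-right-border : RightBorder w → ⊥
      no-right-border (inj₁ refl) = <⇒≱ w<z z≤last
      no-right-border (inj₂ L≢) = L≢ (trans (const (≤-trans a≤p p≤w , <⇒≤ w<z))
        (sym (const (≤-trans a≤p (m≤n⇒m≤1+n p≤w) , w<z))))

  module _ {b b′ : Block} (runBlock : IsRunBlock b) (runBlock′ : IsRunBlock b′) where

    private
      isBlock = proj₁ runBlock
      isBlock′ = proj₁ runBlock′
      i′≤j′ = proj₁ (proj₂ isBlock′)

    collision⇒column⊆rows : ∀ {x y p} → x ≤ d b → y ≤ d b′ → y ≤ x →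
      p ∈ᴵ column b x → p ∈ᴵ column b′ y → column b (x ∸ y) ⊆ᴵ rows b′
    collision⇒column⊆rows {x} {y} x≤d y≤d′ y≤x p∈ p∈′
      with column-cover isBlock x≤d p∈ | column-cover isBlock′ y≤d′ p∈′
    ... | k , k∈ , refl | k′ , k′∈ , LF^k′≡ =
      constant⊆bordered (column-constant isBlock s≤d) (column⊆positions isBlock s)
        (proj₁ (proj₂ runBlock′)) (proj₁ (proj₂ (proj₂ runBlock′)))
        (LF^-∈-column isBlock s≤d k∈) (subst (_∈ᴵ rows b′) (sym LF^k≡k′) k′∈)
      where
      s = x ∸ y
      s≤d : s ≤ d b
      s≤d = ≤-trans (m∸n≤m x y) x≤d
      LF^k≡k′ : LF^ s k ≡ k′
      LF^k≡k′ = LF^-injective y (LF^-range s (rows⊆positions isBlock k∈)) (rows⊆positions isBlock′ k′∈)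
                  (trans (sym (LF^-∸ y≤x k)) (sym LF^k′≡))

    collision⇒column⊆column : ∀ {x y p} → x ≤ d b → y ≤ d b′ → y ≤ x →
      p ∈ᴵ column b x → p ∈ᴵ column b′ y → column b x ⊆ᴵ column b′ y
    collision⇒column⊆column {x} {y} x≤d y≤d′ y≤x p∈ p∈′ =
      subst (LF^ y (i b′) ≤_) (sym (LF^-∸ y≤x (i b)))
        (column-mono isBlock′ y≤d′ (≤-refl , i′≤j′) lo∈ (proj₁ lo∈)) ,
      subst (_≤ LF^ y (j b′)) (sym (LF^-∸ y≤x (j b)))
        (column-mono isBlock′ y≤d′ hi∈ (i′≤j′ , ≤-refl) (proj₂ hi∈))
      where
      ends∈ = column-ends-∈ isBlock (≤-trans (m∸n≤m x y) x≤d) (collision⇒column⊆rows x≤d y≤d′ y≤x p∈ p∈′)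
      lo∈ = proj₁ ends∈
      hi∈ = proj₂ ends∈

  restrict-block : ∀ {b s} → IsBlock b → s ≤ d b → IsBlock (blk s (i b) (j b))
  restrict-block (1≤i , i≤j , j≤n , sameChar) s≤d =
    1≤i , i≤j , j≤n , λ x x≤s → sameChar x (≤-trans x≤s s≤d)

  point-block : ∀ {s k} → k ∈ᴵ positions → IsBlock (blk s k k)
  point-block (1≤k , k≤n) =
    1≤k , ≤-refl , k≤n , λ x _ k′ k≤k′ k′≤k → cong (λ r → L (LF^ x r)) (≤-antisym k′≤k k≤k′)

  glue-block : ∀ {s i₀ j₀ b′} → IsBlock (blk s i₀ j₀) → IsBlock b′ →
    LF^ s i₀ ≡ i b′ → LF^ s j₀ ≡ j b′ → IsBlock (blk (d b′ + s) i₀ j₀)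
  glue-block {s} {i₀} {j₀} {b′} prefix@(1≤i , i≤j , j≤n , samePrefix) isBlock′ lo≡ hi≡ =
    1≤i , i≤j , j≤n , sameChar
    where
    sameChar : ∀ x → x ≤ d b′ + s → ∀ k → i₀ ≤ k → k ≤ j₀ → L (LF^ x k) ≡ L (LF^ x i₀)
    sameChar x x≤ k i≤k k≤j with x ≤? s
    ... | yes x≤s = samePrefix x x≤s k i≤k k≤j
    ... | no  x≰s = begin
      L (LF^ x k)          ≡⟨ cong L (LF^-split k) ⟩
      L (LF^ t (LF^ s k))  ≡⟨ proj₂ (proj₂ (proj₂ isBlock′)) t t≤d′ (LF^ s k) i′≤ ≤j′ ⟩
      L (LF^ t (i b′))     ≡⟨ cong (λ r → L (LF^ t r)) (sym lo≡) ⟩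
      L (LF^ t (LF^ s i₀)) ≡⟨ cong L (sym (LF^-split i₀)) ⟩
      L (LF^ x i₀)         ∎
      where
      open ≡-Reasoning
      t = x ∸ s
      LF^-split : ∀ r → LF^ x r ≡ LF^ t (LF^ s r)
      LF^-split r = trans (cong (λ u → LF^ u r) (sym (m∸n+n≡m (<⇒≤ (≰⇒> x≰s))))) (LF^-+ t s r)
      t≤d′ : t ≤ d b′
      t≤d′ = subst (t ≤_) (m+n∸n≡m (d b′) s) (∸-monoˡ-≤ s x≤)
      LF^k∈ : LF^ s k ∈ᴵ column (blk s i₀ j₀) s
      LF^k∈ = LF^-∈-column prefix ≤-refl (i≤k , k≤j)
      i′≤ : i b′ ≤ LF^ s k
      i′≤ = subst (_≤ LF^ s k) lo≡ (proj₁ LF^k∈)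
      ≤j′ : LF^ s k ≤ j b′
      ≤j′ = subst (LF^ s k ≤_) hi≡ (proj₂ LF^k∈)

  -- The prefix block followed by b′ is a run-block of the same height colliding with b′
  -- and wider than it.
  widthMaximal-unextendable : ∀ {s i₀ j₀ b′} → IsWidthMaximal b′ →
    IsBlock (blk s i₀ j₀) → LeftBorder i₀ → RightBorder j₀ → 1 ≤ s →
    LF^ s i₀ ≡ i b′ → LF^ s j₀ ≡ j b′ → ⊥
  widthMaximal-unextendable {s} {i₀} {j₀} {b′} (runBlock′ , maximal) prefix left right 1≤s lo≡ hi≡ =
    <⇒≱ (m<m+n (d b′) 1≤s) (≤-pred (maximal extended extendedRunBlock collides sameHeight))
    where
    open ≡-Reasoning
    isBlock′ = proj₁ runBlock′
    i′≤j′ = proj₁ (proj₂ isBlock′)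
    extended = blk (d b′ + s) i₀ j₀

    LF^-ends : ∀ {r r′} → LF^ s r ≡ r′ → LF^ (d b′ + s) r ≡ LF^ (d b′) r′
    LF^-ends {r} LF^≡ = trans (LF^-+ (d b′) s r) (cong (LF^ (d b′)) LF^≡)

    extendedRunBlock : IsRunBlock extended
    extendedRunBlock = glue-block prefix isBlock′ lo≡ hi≡ , left , right ,
      subst LeftBorder (sym (LF^-ends lo≡)) (proj₁ (proj₂ (proj₂ (proj₂ runBlock′)))) ,
      subst RightBorder (sym (LF^-ends hi≡)) (proj₂ (proj₂ (proj₂ (proj₂ runBlock′))))

    collides : Collide b′ extended
    collides = (λ b′≡ → <⇒≢ (m<m+n (d b′) 1≤s) (cong d b′≡)) ,
      0 , s , i b′ , z≤n , m≤n+m s (d b′) , (≤-refl , i′≤j′) ,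
      (≤-reflexive lo≡ , subst (i b′ ≤_) (sym hi≡) i′≤j′)

    j′≡ : j b′ ≡ i b′ + (j₀ ∸ i₀)
    j′≡ = trans (sym hi≡) (trans (column-length prefix ≤-refl) (cong (_+ (j₀ ∸ i₀)) lo≡))

    sameHeight : height extended ≡ height b′
    sameHeight = begin
      suc j₀ ∸ i₀                   ≡⟨ +-∸-assoc 1 (proj₁ (proj₂ prefix)) ⟩
      suc (j₀ ∸ i₀)                 ≡⟨ sym (m+n∸m≡n (i b′) (suc (j₀ ∸ i₀))) ⟩
      i b′ + suc (j₀ ∸ i₀) ∸ i b′   ≡⟨ cong (_∸ i b′) (+-suc (i b′) (j₀ ∸ i₀)) ⟩
      suc (i b′ + (j₀ ∸ i₀)) ∸ i b′ ≡⟨ cong (λ r → suc r ∸ i b′) (sym j′≡) ⟩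
      suc (j b′) ∸ i b′             ∎

  widthMaximal⇒i<j : ∀ {b} → IsWidthMaximal b → i b < j b
  widthMaximal⇒i<j {b} wm@((isBlock , left , right , _) , _) with m≤n⇒m<n∨m≡n (proj₁ (proj₂ isBlock))
  ... | inj₁ i<j = i<j
  ... | inj₂ i≡j with LF^-periodic (rows⊆positions isBlock (≤-refl , proj₁ (proj₂ isBlock)))
  ...   | q , 1≤q , LF^q≡ = ⊥-elim (widthMaximal-unextendable wm prefix left right 1≤q
                              LF^q≡ (subst (λ r → LF^ q r ≡ r) i≡j LF^q≡))
    where
    prefix : IsBlock (blk q (i b) (j b))
    prefix = subst (λ r → IsBlock (blk q (i b) r)) i≡j
               (point-block (rows⊆positions isBlock (≤-refl , proj₁ (proj₂ isBlock))))

  widthMaximal-rows-injective : ∀ {b b′} → IsWidthMaximal b → IsWidthMaximal b′ →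
    rows b ≡ rows b′ → b ≡ b′
  widthMaximal-rows-injective {blk d₁ i₁ j₁} {blk d₂ _ _} (runBlock , maximal) (runBlock′ , maximal′) refl
    with d₁ ≟ d₂
  ... | yes refl = refl
  ... | no  d₁≢d₂ = ⊥-elim (d₁≢d₂ (≤-antisym
          (≤-pred (maximal′ _ runBlock (collide-at-rows (λ e → d₁≢d₂ (sym e))) refl))
          (≤-pred (maximal _ runBlock′ (collide-at-rows d₁≢d₂) refl))))
    where
    row₁ : i₁ ∈ᴵ (i₁ , j₁)
    row₁ = ≤-refl , proj₁ (proj₂ (proj₁ runBlock))
    collide-at-rows : ∀ {c c′} → c ≢ c′ → Collide (blk c i₁ j₁) (blk c′ i₁ j₁)
    collide-at-rows c≢c′ = (λ e → c≢c′ (cong d e)) , 0 , 0 , i₁ , z≤n , z≤n , row₁ , row₁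

  widthMaximal-rows-overlap⇒≡ : ∀ {b b′ p} → IsWidthMaximal b → IsWidthMaximal b′ →
    p ∈ᴵ rows b → p ∈ᴵ rows b′ → b ≡ b′
  widthMaximal-rows-overlap⇒≡ {b} {b′} wm@(runBlock , _) wm′@(runBlock′ , _) p∈ p∈′ =
    widthMaximal-rows-injective wm wm′
      (cong₂ _,_ (≤-antisym (proj₁ b′⊆b) (proj₁ b⊆b′)) (≤-antisym (proj₂ b⊆b′) (proj₂ b′⊆b)))
    where
    rows⊆bordered : ∀ {c c′} → IsRunBlock c → IsRunBlock c′ → ∀ {p} →
      p ∈ᴵ rows c → p ∈ᴵ rows c′ → rows c ⊆ᴵ rows c′
    rows⊆bordered (isBlock , _) (_ , left′ , right′ , _) =
      constant⊆bordered (column-constant isBlock z≤n) (column⊆positions isBlock 0) left′ right′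
    b⊆b′ = rows⊆bordered runBlock runBlock′ p∈ p∈′
    b′⊆b = rows⊆bordered runBlock′ runBlock p∈′ p∈

  equal-columns⇒column≡rows : ∀ {b b′ x y} → IsBlock b → IsBlock b′ → y ≤ x →
    column b x ≡ column b′ y → column b (x ∸ y) ≡ rows b′
  equal-columns⇒column≡rows {b} {b′} {x} {y} isBlock isBlock′ y≤x columns≡ =
    cong₂ _,_ (cancel-LF^y (≤-refl , i≤j) (≤-refl , i′≤j′) (cong proj₁ columns≡))
              (cancel-LF^y (i≤j , ≤-refl) (i′≤j′ , ≤-refl) (cong proj₂ columns≡))
    where
    i≤j = proj₁ (proj₂ isBlock)
    i′≤j′ = proj₁ (proj₂ isBlock′)
    cancel-LF^y : ∀ {k k′} → k ∈ᴵ rows b → k′ ∈ᴵ rows b′ → LF^ x k ≡ LF^ y k′ → LF^ (x ∸ y) k ≡ k′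
    cancel-LF^y k∈ k′∈ LF^≡ = LF^-injective y (LF^-range (x ∸ y) (rows⊆positions isBlock k∈))
      (rows⊆positions isBlock′ k′∈) (trans (sym (LF^-∸ y≤x _)) LF^≡)

  widthMaximal-column-injective : ∀ {b b′ x y} → IsWidthMaximal b → IsWidthMaximal b′ →
    x ≤ d b → y ≤ d b′ → y ≤ x → column b x ≡ column b′ y → b ≡ b′ × x ≡ y
  widthMaximal-column-injective {b} {b′} {x} {y} wm@((isBlock , left , right , _) , _) wm′ x≤d _ y≤x columns≡
    with equal-columns⇒column≡rows isBlock (proj₁ (proj₁ wm′)) y≤x columns≡ | m≤n⇒m<n∨m≡n y≤x
  ... | column≡rows | inj₁ y<x = ⊥-elim (widthMaximal-unextendable wm′
          (restrict-block isBlock (≤-trans (m∸n≤m x y) x≤d)) left right (m<n⇒0<n∸m y<x)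
          (cong proj₁ column≡rows) (cong proj₂ column≡rows))
  ... | column≡rows | inj₂ refl = widthMaximal-rows-injective wm wm′
          (trans (cong (column b) (sym (n∸n≡0 x))) column≡rows) , refl

  module _ (RB : List Block) (widthMaximal : All IsWidthMaximal RB) where

    private
      wm : ∀ {b} → b ∈ RB → IsWidthMaximal b
      wm = All.lookup widthMaximal

      runBlock : ∀ {b} → b ∈ RB → IsRunBlock b
      runBlock b∈ = proj₁ (wm b∈)

      isBlock : ∀ {b} → b ∈ RB → IsBlock b
      isBlock b∈ = proj₁ (runBlock b∈)

    CollidingPair : Block × Block → Set
    CollidingPair q = proj₁ q ∈ RB × proj₂ q ∈ RB × Collide (proj₁ q) (proj₂ q)

    ChargedTo : Block × Block → Block × ℕ → Set
    ChargedTo q (b , z) = ∃[ b′ ] b′ ∈ RB × (q ≡ (b , b′) ⊎ q ≡ (b′ , b)) × LF^ z (i b) ∈ᴵ rows b′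

    chargedTo-injective : ∀ {q r v} → ChargedTo q v → ChargedTo r v → SameUnorderedPair q r
    chargedTo-injective (b′ , b′∈ , q≡ , in′) (b″ , b″∈ , r≡ , in″)
      with widthMaximal-rows-overlap⇒≡ (wm b′∈) (wm b″∈) in′ in″
    ... | refl = orientations⇒SameUnorderedPair q≡ r≡

    collision-charge : ∀ {q} → CollidingPair q → ∃[ v ] v ∈ columns RB × ChargedTo q v
    collision-charge {b₁ , b₂} (b₁∈ , b₂∈ , _ , x , y , p , x≤d , y≤d , p∈ , p∈′) with ≤-total y x
    ... | inj₁ y≤x = (b₁ , x ∸ y) , ∈-columns⁺ b₁∈ s≤d , b₂ , b₂∈ , inj₁ refl ,
          proj₁ (column-ends-∈ (isBlock b₁∈) s≤d
            (collision⇒column⊆rows (runBlock b₁∈) (runBlock b₂∈) x≤d y≤d y≤x p∈ p∈′))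
      where s≤d = ≤-trans (m∸n≤m x y) x≤d
    ... | inj₂ x≤y = (b₂ , y ∸ x) , ∈-columns⁺ b₂∈ s≤d , b₁ , b₁∈ , inj₂ refl ,
          proj₁ (column-ends-∈ (isBlock b₂∈) s≤d
            (collision⇒column⊆rows (runBlock b₂∈) (runBlock b₁∈) y≤d x≤d x≤y p∈′ p∈))
      where s≤d = ≤-trans (m∸n≤m y x) y≤d

    collisions≤totalWidth : (P : List (Block × Block)) → All CollidingPair P →
      AllPairs (λ q r → ¬ SameUnorderedPair q r) P → length P ≤ totalWidth RB
    collisions≤totalWidth P colliding distinct = subst (length P ≤_) (length-columns RB)
      (length-≤-by-injection ChargedTo (λ {q r v} → chargedTo-injective {q} {r} {v}) distinct
        (All.map collision-charge colliding))

    columnOf : Block × ℕ → Interval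
    columnOf (b , x) = column b x

    columnIntervals : List Interval
    columnIntervals = map columnOf (columns RB)

    columnIntervals-laminar : Laminar columnIntervals
    columnIntervals-laminar I∈ J∈ p∈I p∈J with ∈-map⁻ columnOf I∈ | ∈-map⁻ columnOf J∈
    ... | (b , x) , v∈ , refl | (b′ , y) , v′∈ , refl with ∈-columns⁻ v∈ | ∈-columns⁻ v′∈ | ≤-total y x
    ...   | b∈ , x≤d | b′∈ , y≤d | inj₁ y≤x =
            inj₁ (collision⇒column⊆column (runBlock b∈) (runBlock b′∈) x≤d y≤d y≤x p∈I p∈J)
    ...   | b∈ , x≤d | b′∈ , y≤d | inj₂ x≤y =
            inj₂ (collision⇒column⊆column (runBlock b′∈) (runBlock b∈) y≤d x≤d x≤y p∈J p∈I)

    column-nontrivial : ∀ {v} → v ∈ columns RB → proj₁ (columnOf v) < proj₂ (columnOf v)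
    column-nontrivial {b , x} v∈ with ∈-columns⁻ v∈
    ... | b∈ , x≤d = subst (LF^ x (i b) <_) (sym (column-length (isBlock b∈) x≤d))
                       (m<m+n (LF^ x (i b)) (m<n⇒0<n∸m (widthMaximal⇒i<j (wm b∈))))

    columnIntervals-nontrivial : ∀ {K} → K ∈ columnIntervals → proj₁ K < proj₂ K
    columnIntervals-nontrivial K∈ with ∈-map⁻ columnOf K∈
    ... | _ , v∈ , refl = column-nontrivial v∈

    columnOf-injective : ∀ {v v′} → v ∈ columns RB → v′ ∈ columns RB → columnOf v ≡ columnOf v′ → v ≡ v′
    columnOf-injective {b , x} {b′ , y} v∈ v′∈ column≡ with ∈-columns⁻ v∈ | ∈-columns⁻ v′∈ | ≤-total y x
    ... | b∈ , x≤d | b′∈ , y≤d | inj₁ y≤x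
        with widthMaximal-column-injective (wm b∈) (wm b′∈) x≤d y≤d y≤x column≡
    ...   | refl , refl = refl
    columnOf-injective {b , x} {b′ , y} v∈ v′∈ column≡ | b∈ , x≤d | b′∈ , y≤d | inj₂ x≤y
        with widthMaximal-column-injective (wm b′∈) (wm b∈) y≤d x≤d x≤y (sym column≡)
    ...   | refl , refl = refl

    code : Block × ℕ → ℕ
    code v = splitPoint columnIntervals (columnOf v)

    Encodes : Block × ℕ → ℕ → Set
    Encodes v c = v ∈ columns RB × c ≡ code v

    encodes-injective : ∀ {v v′ c} → Encodes v c → Encodes v′ c → v ≡ v′
    encodes-injective (v∈ , c≡) (v′∈ , c≡′) = columnOf-injective v∈ v′∈
      (splitPoint-injective columnIntervals columnIntervals-laminar columnIntervals-nontrivial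
        (∈-map⁺ columnOf v∈) (∈-map⁺ columnOf v′∈) (trans (sym c≡) c≡′))

    code-∈ : ∀ {v} → v ∈ columns RB → ∃[ c ] c ∈ upTo n × Encodes v c
    code-∈ {b , x} v∈ = code (b , x) ,
      ∈-upTo⁺ (<-≤-trans (splitPoint-< columnIntervals (column-nontrivial v∈))
                         (proj₂ (column⊆positions (isBlock (proj₁ (∈-columns⁻ v∈))) x))) ,
      v∈ , refl

    totalWidth≤n : Unique RB → totalWidth RB ≤ n
    totalWidth≤n unique = subst₂ _≤_ (length-columns RB) (length-upTo n)
      (length-≤-by-injection Encodes encodes-injective (columns-unique unique) (All.tabulate code-∈))

lemma15 : (S : List ℕ) (SA : ℕ → ℕ) → NullTerminated S → IsSuffixArray S SA →
    (RB : List Block) → Unique RB → All (BWT.IsWidthMaximal S SA) RB →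
    ((P : List (Block × Block)) →
      All (λ q → proj₁ q ∈ RB × proj₂ q ∈ RB × BWT.Collide S SA (proj₁ q) (proj₂ q)) P →
      AllPairs (λ q r → ¬ SameUnorderedPair q r) P →
      length P ≤ totalWidth RB)
    × totalWidth RB ≤ length S
lemma15 S SA _ _ RB unique widthMaximal =
  collisions≤totalWidth RB widthMaximal , totalWidth≤n RB widthMaximal unique
  where open WidthMaximalRunBlocks S SA
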